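{- For all integers $n \geq 3$ and $k \geq 4$, $h(n,k) \geq n$.
   Context: All graphs are finite and simple. A degree monotone path in a graph $G$ is a path $v_1v_2\ldots v_m$ such that $\deg(v_1)\le\cdots\le\deg(v_m)$ or $\deg(v_1)\ge\cdots\ge\deg(v_m)$, where degrees are taken in $G$. Its length is its number of vertices $m$. $mp(G)$ denotes the maximum length of a degree monotone path in $G$. For $k\ge 2$, a graph $G$ is called $k$-saturated if $mp(G)<k$ and $mp(G+e)\ge k$ for every edge $e$ joining two nonadjacent vertices of $G$, where $G+e$ is $G$ with $e$ added. In particular, every complete graph $K_m$ with $m\le k-1$ is $k$-saturated. $h(n,k)$ is the minimum number of edges of a $k$-saturated graph on $n$ vertices. -}

module Defs where

open import Data.Nat using (ℕ; _≤_; _<_; _≥_)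
open import Data.Bool using (Bool; true; false; if_then_else_; _∨_; _∧_)
open import Data.Fin using (Fin; toℕ)
open import Data.Fin.Properties using () renaming (_≟_ to _≟ᶠ_)
open import Data.List using (List; length; map; allFin)
open import Data.Nat.ListAction using (sum)
open import Data.List.Relation.Unary.Linked using (Linked)
open import Data.List.Relation.Unary.Unique.Propositional using (Unique)
open import Data.Product using (_×_; ∃)
open import Data.Sum using (_⊎_)

open import Relation.Nullary.Decidable using (⌊_⌋)
open import Relation.Binary.PropositionalEquality using (_≡_; _≢_)
import Data.Nat as ℕ

Adj : ℕ → Set
Adj n = Fin n → Fin n → Bool

IsSimple : ∀ {n} → Adj n → Set
IsSimple {n} A = (∀ (i j : Fin n) → A i j ≡ A j i) × (∀ (i : Fin n) → A i i ≡ false)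

indicator : Bool → ℕ
indicator b = if b then 1 else 0

deg : ∀ {n} → Adj n → Fin n → ℕ
deg {n} A i = sum (map (λ j → indicator (A i j)) (allFin n))

edgeCount : ∀ {n} → Adj n → ℕ
edgeCount {n} A =
  sum (map (λ i → sum (map (λ j → indicator (⌊ toℕ i ℕ.<? toℕ j ⌋ ∧ A i j)) (allFin n))) (allFin n))

IsPath : ∀ {n} → Adj n → List (Fin n) → Set
IsPath A p = Unique p × Linked (λ u v → A u v ≡ true) p

-- degree monotone path (degrees taken in A); its length is its number of vertices
IsDegMonotonePath : ∀ {n} → Adj n → List (Fin n) → Set
IsDegMonotonePath A p =
  IsPath A p × (Linked _≤_ (map (deg A) p) ⊎ Linked _≥_ (map (deg A) p))

MpLess : ∀ {n} → Adj n → ℕ → Set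
MpLess {n} A k = ∀ (p : List (Fin n)) → IsDegMonotonePath A p → length p < k

MpAtLeast : ∀ {n} → Adj n → ℕ → Set
MpAtLeast {n} A k = ∃ λ (p : List (Fin n)) → IsDegMonotonePath A p × k ≤ length p

addEdge : ∀ {n} → Adj n → Fin n → Fin n → Adj n
addEdge A u v i j =
  A i j ∨ ((⌊ i ≟ᶠ u ⌋ ∧ ⌊ j ≟ᶠ v ⌋) ∨ (⌊ i ≟ᶠ v ⌋ ∧ ⌊ j ≟ᶠ u ⌋))

KSaturated : ∀ {n} → ℕ → Adj n → Set
KSaturated {n} k A =
  MpLess A k ×
  (∀ (u v : Fin n) → u ≢ v → A u v ≡ false → MpAtLeast (addEdge A u v) k)

module Submission where

-- Saturation is used in one way only: a non-edge uv such that G + uv still has no degree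
-- monotone path on k vertices contradicts k-saturation; call such an edge harmless. A path
-- is monotone iff it or its reverse is degree-nonincreasing ("descending"), so it suffices
-- to bound descending paths of G + uv, typically by showing they are descending in G.
-- For saturated G this refutes, in turn:
--   * an isolated vertex u: joining u to a vertex v of maximum degree is harmless;
--   * a component that is a path on ≥ 3 vertices: closing a triangle at an end is harmless;
--   * a leaf u whose neighbour w is not the unique vertex of maximum degree or has degree
--     ≤ 2: joining u to a vertex v of maximum degree among the rest is harmless;
--   * two leaves: both hang at that unique w, and joining them is harmless.
-- So the degree sum is at least 2n - 1, and the handshake lemma gives ≥ n edges.

open import Defs
open import Data.Nat using (ℕ; zero; suc; _+_; _≤_; _<_; z≤n; s≤s)
open import Data.Nat.Properties
open import Algebra.Properties.CommutativeSemigroup +-commutativeSemigroup using (interchange)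
open import Data.Nat.ListAction using (sum)
open import Data.Bool using (Bool; true; false; _∧_; _∨_)
open import Data.Bool.Properties using (T?; T-≡; ∨-identityʳ; ∨-comm; ∧-comm; ¬-not)
open import Data.Fin using (Fin; toℕ)
open import Data.Fin.Properties using (toℕ-injective) renaming (_≟_ to _≟ᶠ_)
open import Data.List using (List; []; _∷_; length; map; allFin; filter; _++_; reverse; reverseAcc)
open import Data.List.Properties using (length-++; length-tabulate; length-reverse; map-cong)
open import Data.List.Relation.Unary.Any using (here; there; any?)
import Data.List.Relation.Unary.Any.Properties as Any
open import Data.List.Relation.Unary.All using (All; []; _∷_; all?)
import Data.List.Relation.Unary.All as All
open import Data.List.Relation.Unary.All.Properties.Core using (¬All⇒Any¬; ¬Any⇒All¬)
open import Data.List.Relation.Unary.All.Properties using (all-filter)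
open import Data.List.Extrema.Nat using (argmax; argmax-all; f[xs]≤f[argmax])
open import Data.List.Relation.Unary.AllPairs using ([]; _∷_)
import Data.List.Relation.Unary.AllPairs as AllPairs
open import Data.List.Relation.Unary.Linked using (Linked; []; [-]; _∷_)
import Data.List.Relation.Unary.Linked as Linked
import Data.List.Relation.Unary.Linked.Properties as Linked
open import Data.List.Membership.Propositional using (_∈_; _∉_; find)
open import Data.List.Membership.Propositional.Properties
  using (∈-allFin; ∈-∃++; ∈-++⁻; ∈-++⁺ˡ; ∈-++⁺ʳ; ∈-filter⁺; ∈-filter⁻)
open import Data.List.Relation.Unary.Unique.Propositional using (Unique)
open import Data.List.Relation.Unary.Unique.Propositional.Properties using (allFin⁺; filter⁺)
open import Data.Product using (_×_; _,_; proj₁; proj₂; ∃)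
open import Data.Sum using (_⊎_; inj₁; inj₂; [_,_]′)
open import Data.Empty using (⊥; ⊥-elim)
open import Data.Unit using (tt)
open import Function using (_∘_; id; flip; Equivalence)
open import Relation.Nullary using (¬_; Dec; yes; no; contradiction; ¬?)
open import Relation.Nullary.Decidable using (⌊_⌋; toWitness)
import Data.List.Relation.Binary.Permutation.Setoid as Perm
import Data.List.Relation.Binary.Permutation.Setoid.Properties as PermProps
open import Relation.Binary.PropositionalEquality.Properties using (setoid)
open import Relation.Binary.PropositionalEquality
  using (_≡_; _≢_; refl; sym; trans; cong; subst; subst₂; module ≡-Reasoning)

private variable
  n : ℕ
  X : Set

_∈?_ : (x : Fin n) (xs : List (Fin n)) → Dec (x ∈ xs)
x ∈? xs = any? (x ≟ᶠ_) xs

length-mono : {L M : List X} → Unique L → (∀ {x} → x ∈ L → x ∈ M) → length L ≤ length M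
length-mono {L = []} _ _ = z≤n
length-mono {L = x ∷ L} {M} (x∉L ∷ uL) L⊆M with ∈-∃++ (L⊆M (here refl))
... | ys , zs , refl = ≤-trans (s≤s (length-mono uL L⊆ys++zs)) (≤-reflexive length-removed)
  where
  L⊆ys++zs : ∀ {y} → y ∈ L → y ∈ ys ++ zs
  L⊆ys++zs y∈L with ∈-++⁻ ys (L⊆M (there y∈L))
  ... | inj₁ y∈ys = ∈-++⁺ˡ y∈ys
  ... | inj₂ (here refl) = contradiction refl (All.lookup x∉L y∈L)
  ... | inj₂ (there y∈zs) = ∈-++⁺ʳ ys y∈zs
  length-removed : suc (length (ys ++ zs)) ≡ length (ys ++ x ∷ zs)
  length-removed = begin
    suc (length (ys ++ zs))         ≡⟨ cong suc (length-++ ys) ⟩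
    suc (length ys + length zs)     ≡⟨ sym (+-suc (length ys) (length zs)) ⟩
    length ys + length (x ∷ zs)     ≡⟨ sym (length-++ ys) ⟩
    length (ys ++ x ∷ zs)           ∎
    where open ≡-Reasoning

escape : {L M : List (Fin n)} → Unique M → length L < length M → ∃ λ x → x ∈ M × x ∉ L
escape {L = L} {M} uM L<M with all? (_∈? L) M
... | yes M⊆L = contradiction (length-mono uM (All.lookup M⊆L)) (<⇒≱ L<M)
... | no M⊈L = find (¬All⇒Any¬ (_∈? L) M M⊈L)

Σ[_] : List X → (X → ℕ) → ℕ
Σ[ xs ] f = sum (map f xs)

count : (X → Bool) → List X → ℕ
count p xs = Σ[ xs ] (λ x → indicator (p x))

count≡length-filter : (p : X → Bool) (xs : List X) → count p xs ≡ length (filter (T? ∘ p) xs)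
count≡length-filter p [] = refl
count≡length-filter p (x ∷ xs) with p x
... | true = cong suc (count≡length-filter p xs)
... | false = count≡length-filter p xs

at-most-one : {L : List X} → Unique L → (∀ {x y} → x ∈ L → y ∈ L → x ≡ y) → length L ≤ 1
at-most-one {L = []} _ _ = z≤n
at-most-one {L = x ∷ _} u all-equal = length-mono {M = x ∷ []} u λ y∈L → here (all-equal y∈L (here refl))

Σ-+ : (xs : List X) (f g : X → ℕ) → Σ[ xs ] (λ x → f x + g x) ≡ Σ[ xs ] f + Σ[ xs ] g
Σ-+ [] f g = refl
Σ-+ (x ∷ xs) f g = trans (cong (f x + g x +_) (Σ-+ xs f g)) (interchange (f x) (g x) (Σ[ xs ] f) (Σ[ xs ] g))

Σ-cong : (xs : List X) {f g : X → ℕ} → (∀ x → f x ≡ g x) → Σ[ xs ] f ≡ Σ[ xs ] g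
Σ-cong xs f≗g = cong sum (map-cong f≗g xs)

Σ-zero : (xs : List X) → Σ[ xs ] (λ _ → 0) ≡ 0
Σ-zero [] = refl
Σ-zero (_ ∷ xs) = Σ-zero xs

Σ-swap : ∀ {Y : Set} (xs : List X) (ys : List Y) (f : X → Y → ℕ) →
         Σ[ xs ] (λ x → Σ[ ys ] (f x)) ≡ Σ[ ys ] (λ y → Σ[ xs ] (λ x → f x y))
Σ-swap [] ys f = sym (Σ-zero ys)
Σ-swap (x ∷ xs) ys f =
  trans (cong (Σ[ ys ] (f x) +_) (Σ-swap xs ys f)) (sym (Σ-+ ys (f x) λ y → Σ[ xs ] (λ x' → f x' y)))

Σ-≥2 : (xs : List X) {f : X → ℕ} → (∀ x → 2 ≤ f x) → length xs + length xs ≤ Σ[ xs ] f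
Σ-≥2 [] _ = z≤n
Σ-≥2 (x ∷ xs) {f} 2≤f =
  subst (_≤ f x + Σ[ xs ] f) (sym (cong suc (+-suc (length xs) (length xs))))
        (+-mono-≤ (2≤f x) (Σ-≥2 xs 2≤f))

halve : ∀ m e → m + m ≤ e + e + 1 → m ≤ e
halve zero e _ = z≤n
halve (suc m) zero (s≤s h) = contradiction (subst (_≤ 0) (+-suc m m) h) λ ()
halve (suc m) (suc e) (s≤s h) = s≤s (halve m e (≤-pred (subst₂ _≤_ (+-suc m m) (cong (_+ 1) (+-suc e e)) h)))

nbrs : Adj n → Fin n → List (Fin n)
nbrs {n} A i = filter (T? ∘ A i) (allFin n)

module _ {n} (A : Adj n) where

  deg≡length-nbrs : ∀ i → deg A i ≡ length (nbrs A i)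
  deg≡length-nbrs i = count≡length-filter (A i) (allFin n)

  ∈-nbrs : ∀ {i j} → A i j ≡ true → j ∈ nbrs A i
  ∈-nbrs {i} {j} a = ∈-filter⁺ (T? ∘ A i) (∈-allFin j) (Equivalence.from T-≡ a)

  nbrs-adj : ∀ {i j} → j ∈ nbrs A i → A i j ≡ true
  nbrs-adj {i} m = Equivalence.to T-≡ (proj₂ (∈-filter⁻ (T? ∘ A i) {xs = allFin n} m))

  deg-lower : ∀ {i} {L : List (Fin n)} → Unique L → (∀ {x} → x ∈ L → A i x ≡ true) →
              length L ≤ deg A i
  deg-lower {i} uL adj =
    subst (_ ≤_) (sym (deg≡length-nbrs i)) (length-mono uL (∈-nbrs ∘ adj))

  deg-upper : ∀ {i} {L : List (Fin n)} → (∀ {j} → A i j ≡ true → j ∈ L) → deg A i ≤ length L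
  deg-upper {i} ⊆L =
    subst (_≤ _) (sym (deg≡length-nbrs i)) (length-mono (filter⁺ _ (allFin⁺ n)) (⊆L ∘ nbrs-adj))

  new-neighbour : ∀ {i} (L : List (Fin n)) → length L < deg A i → ∃ λ j → A i j ≡ true × j ∉ L
  new-neighbour {i} L L<deg with escape (filter⁺ _ (allFin⁺ n)) (subst (_ <_) (deg≡length-nbrs i) L<deg)
  ... | j , j∈N , j∉L = j , nbrs-adj j∈N , j∉L

  deg-cong : ∀ {B : Adj n} {i i'} → (∀ j → A i j ≡ B i' j) → deg A i ≡ deg B i'
  deg-cong row = cong sum (map-cong (cong indicator ∘ row) (allFin n))

  nbr⇒deg≥1 : ∀ {i a} → A i a ≡ true → 1 ≤ deg A i
  nbr⇒deg≥1 a = deg-lower ([] ∷ []) λ { (here refl) → a }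

  two-nbrs : ∀ {i a b} → A i a ≡ true → A i b ≡ true → a ≢ b → 2 ≤ deg A i
  two-nbrs ia ib a≢b = deg-lower ((a≢b ∷ []) ∷ [] ∷ [])
    λ { (here refl) → ia ; (there (here refl)) → ib }

  three-nbrs : ∀ {i a b c} → A i a ≡ true → A i b ≡ true → A i c ≡ true →
               a ≢ b → a ≢ c → b ≢ c → 3 ≤ deg A i
  three-nbrs ia ib ic a≢b a≢c b≢c = deg-lower ((a≢b ∷ a≢c ∷ []) ∷ (b≢c ∷ []) ∷ [] ∷ [])
    λ { (here refl) → ia ; (there (here refl)) → ib ; (there (there (here refl))) → ic }

  sole-nbr : ∀ {i a j} → deg A i ≤ 1 → A i a ≡ true → A i j ≡ true → j ≡ a
  sole-nbr {a = a} {j} d ia ij with j ≟ᶠ a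
  ... | yes j≡a = j≡a
  ... | no j≢a = contradiction (two-nbrs ij ia j≢a) (<⇒≱ (s≤s d))

  two-nbrs-only : ∀ {i a b j} → deg A i ≤ 2 → A i a ≡ true → A i b ≡ true → a ≢ b →
                  A i j ≡ true → j ≡ a ⊎ j ≡ b
  two-nbrs-only {a = a} {b} {j} d ia ib a≢b ij with j ≟ᶠ a | j ≟ᶠ b
  ... | yes j≡a | _ = inj₁ j≡a
  ... | no _ | yes j≡b = inj₂ j≡b
  ... | no j≢a | no j≢b =
    contradiction (three-nbrs ia ib ij a≢b (j≢a ∘ sym) (j≢b ∘ sym)) (<⇒≱ (s≤s d))

  max-deg-outside : (X : List (Fin n)) → ∃ (_∉ X) →
                    ∃ λ v → v ∉ X × (∀ y → y ∉ X → deg A y ≤ deg A v)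
  max-deg-outside X (y₀ , y₀∉X) =
    v , argmax-all (deg A) y₀∉X (all-filter (λ y → ¬? (y ∈? X)) (allFin n)) ,
    λ y y∉X → All.lookup (f[xs]≤f[argmax] {f = deg A} y₀ candidates)
                         (∈-filter⁺ (λ y → ¬? (y ∈? X)) (∈-allFin y) y∉X)
    where
    candidates : List (Fin n)
    candidates = filter (λ y → ¬? (y ∈? X)) (allFin n)
    v : Fin n
    v = argmax (deg A) y₀ candidates

-- Handshake lemma: the degree sum is twice the number of edges. Each adjacency A i j
-- is counted in edgeCount either as the pair (i, j) or as the pair (j, i).
adjacency-split : ∀ {n} (A : Adj n) → IsSimple A → ∀ i j →
  indicator (A i j) ≡ indicator (⌊ toℕ i <? toℕ j ⌋ ∧ A i j) + indicator (⌊ toℕ j <? toℕ i ⌋ ∧ A j i)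
adjacency-split A (symmetric , loopless) i j with toℕ i <? toℕ j | toℕ j <? toℕ i
... | yes i<j | yes j<i = contradiction j<i (<⇒≯ i<j)
... | yes _ | no _ = sym (+-identityʳ _)
... | no _ | yes _ = cong indicator (symmetric i j)
... | no i≮j | no j≮i rewrite toℕ-injective (≤-antisym (≮⇒≥ j≮i) (≮⇒≥ i≮j)) | loopless j = refl

handshake : ∀ {n} (A : Adj n) → IsSimple A → Σ[ allFin n ] (deg A) ≡ edgeCount A + edgeCount A
handshake {n} A simple = begin
  Σ[ V ] (deg A)
    ≡⟨ Σ-cong V (λ i → trans (Σ-cong V (adjacency-split A simple i)) (Σ-+ V _ _)) ⟩
  Σ[ V ] (λ i → Σ[ V ] (e i) + Σ[ V ] (λ j → e j i))
    ≡⟨ Σ-+ V _ _ ⟩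
  edgeCount A + Σ[ V ] (λ i → Σ[ V ] (λ j → e j i))
    ≡⟨ cong (edgeCount A +_) (Σ-swap V V λ i j → e j i) ⟩
  edgeCount A + edgeCount A
    ∎
  where
  open ≡-Reasoning
  V : List (Fin n)
  V = allFin n
  e : Fin n → Fin n → ℕ
  e i j = indicator (⌊ toℕ i <? toℕ j ⌋ ∧ A i j)

linked-reverseAcc : ∀ {R : X → X → Set} {y ys acc} → Linked R (y ∷ ys) → Linked (flip R) (y ∷ acc) →
                    Linked (flip R) (reverseAcc (y ∷ acc) ys)
linked-reverseAcc [-] racc = racc
linked-reverseAcc (r ∷ l) racc = linked-reverseAcc l (r ∷ racc)

linked-reverse : ∀ {R : X → X → Set} {xs} → Linked R xs → Linked (flip R) (reverse xs)
linked-reverse {xs = []} _ = []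
linked-reverse {xs = _ ∷ _} l = linked-reverseAcc l [-]

unique-reverse : ∀ {xs : List X} → Unique xs → Unique (reverse xs)
unique-reverse {X} {xs} =
  PermProps.Unique-resp-↭ (setoid X) (Perm.↭-sym (setoid X) (PermProps.↭-reverse (setoid X) xs))

Step : Adj n → Fin n → Fin n → Set
Step A x y = A x y ≡ true × deg A y ≤ deg A x

-- Degree-nonincreasing ("descending") paths; every monotone path is one, read in some direction.
Descending : Adj n → List (Fin n) → Set
Descending A p = Unique p × Linked (Step A) p

StrictMax : Adj n → Fin n → Set
StrictMax A w = ∀ y → y ≢ w → deg A y < deg A w

module _ {n} {A : Adj n} where

  descending⇒monotone : ∀ {p} → Descending A p → IsDegMonotonePath A p
  descending⇒monotone (u , l) =
    (u , Linked.map proj₁ l) , inj₂ (Linked.map⁺ (Linked.map proj₂ l))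

  monotone⇒descending : IsSimple A → ∀ {p} → IsDegMonotonePath A p →
                        Descending A p ⊎ Descending A (reverse p)
  monotone⇒descending _ ((u , adj) , inj₂ down) = inj₁ (u , Linked.zip (adj , Linked.map⁻ down))
  monotone⇒descending (symmetric , _) ((u , adj) , inj₁ up) =
    inj₂ (unique-reverse u ,
          Linked.map (λ (a , d) → trans (symmetric _ _) a , d)
                     (linked-reverse (Linked.zip (adj , Linked.map⁻ up))))

  mp<-from-descending : ∀ {k} → IsSimple A → (∀ p → Descending A p → length p < k) → MpLess A k
  mp<-from-descending simple bound p mono with monotone⇒descending simple mono
  ... | inj₁ desc = bound p desc
  ... | inj₂ desc = subst (_< _) (length-reverse p) (bound (reverse p) desc)

  descending-bound : ∀ {k p} → MpLess A k → Descending A p → length p < k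
  descending-bound mp desc = mp _ (descending⇒monotone desc)

  descending-tail : ∀ {x p} → Descending A (x ∷ p) → Descending A p
  descending-tail (_ ∷ u , l) = u , Linked.tail l

  head-fresh : ∀ {x p} → Descending A (x ∷ p) → x ∉ p
  head-fresh (x∉p ∷ _ , _) x∈p = All.lookup x∉p x∈p refl

  head-max : ∀ {x p y} → Descending A (x ∷ p) → y ∈ p → deg A y ≤ deg A x
  head-max (_ , (_ , d) ∷ _) (here refl) = d
  head-max (_ ∷ u , (_ , d) ∷ l) (there m) = ≤-trans (head-max (u , l) m) d

  strict-max-first : ∀ {w x p} → StrictMax A w → Descending A (x ∷ p) → w ∉ p
  strict-max-first {w} {x} w-max desc w∈p with x ≟ᶠ w
  ... | yes refl = head-fresh desc w∈p
  ... | no x≢w = <⇒≱ (w-max x x≢w) (head-max desc w∈p)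

module Simple {n} {A : Adj n} (simple : IsSimple A) where

  adj-sym : ∀ {x y} → A x y ≡ true → A y x ≡ true
  adj-sym {x} {y} a = trans (proj₁ simple y x) a

  adj-distinct : ∀ {x y} → A x y ≡ true → x ≢ y
  adj-distinct {x} a refl = contradiction (trans (sym a) (proj₂ simple x)) λ ()

module AddEdge {n} (A : Adj n) (u v : Fin n) where

  A' : Adj n
  A' = addEdge A u v

  keeps-edges : ∀ {i j} → A i j ≡ true → A' i j ≡ true
  keeps-edges a rewrite a = refl

  new-edge : A' u v ≡ true
  new-edge with A u v | u ≟ᶠ u | v ≟ᶠ v
  ... | true | _ | _ = refl
  ... | false | yes _ | yes _ = refl
  ... | false | no u≢u | _ = contradiction refl u≢u
  ... | false | yes _ | no v≢v = contradiction refl v≢v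

  edge-cases : ∀ {i j} → A' i j ≡ true → A i j ≡ true ⊎ (i ≡ u × j ≡ v) ⊎ (i ≡ v × j ≡ u)
  edge-cases {i} {j} a with A i j | i ≟ᶠ u | j ≟ᶠ v | i ≟ᶠ v | j ≟ᶠ u
  ... | true  | _     | _     | _     | _     = inj₁ refl
  ... | false | yes p | yes q | _     | _     = inj₂ (inj₁ (p , q))
  ... | false | _     | _     | yes p | yes q = inj₂ (inj₂ (p , q))
  ... | false | no _  | _     | no _  | _     = contradiction a λ ()
  ... | false | no _  | _     | yes _ | no _  = contradiction a λ ()
  ... | false | yes _ | no _  | no _  | _     = contradiction a λ ()
  ... | false | yes _ | no _  | yes _ | no _  = contradiction a λ ()

  edge-avoiding-v : ∀ {x y} → A' x y ≡ true → x ≢ v → y ≢ v → A x y ≡ true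
  edge-avoiding-v a x≢v y≢v with edge-cases a
  ... | inj₁ old = old
  ... | inj₂ (inj₁ (_ , y≡v)) = contradiction y≡v y≢v
  ... | inj₂ (inj₂ (x≡v , _)) = contradiction x≡v x≢v

  edge-avoiding-u : ∀ {x y} → A' x y ≡ true → x ≢ u → y ≢ u → A x y ≡ true
  edge-avoiding-u a x≢u y≢u with edge-cases a
  ... | inj₁ old = old
  ... | inj₂ (inj₁ (x≡u , _)) = contradiction x≡u x≢u
  ... | inj₂ (inj₂ (_ , y≡u)) = contradiction y≡u y≢u

  row-away : ∀ {i} → i ≢ u → i ≢ v → ∀ j → A' i j ≡ A i j
  row-away {i} i≢u i≢v j with i ≟ᶠ u | i ≟ᶠ v
  ... | yes i≡u | _ = contradiction i≡u i≢u
  ... | no _ | yes i≡v = contradiction i≡v i≢v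
  ... | no _ | no _ = ∨-identityʳ (A i j)

  deg-away : ∀ {i} → i ≢ u → i ≢ v → deg A' i ≡ deg A i
  deg-away {i} i≢u i≢v = deg-cong A' {A} {i} {i} (row-away i≢u i≢v)

  deg-u : u ≢ v → A u v ≡ false → deg A' u ≡ suc (deg A u)
  deg-u u≢v nonadj = ≤-antisym
    (≤-trans (deg-upper A' new-nbrs) (≤-reflexive (cong suc (sym (deg≡length-nbrs A u)))))
    (≤-trans (≤-reflexive (cong suc (deg≡length-nbrs A u)))
             (deg-lower A' (All.tabulate v∉N ∷ filter⁺ _ (allFin⁺ n)) adj'))
    where
    v∉N : ∀ {x} → x ∈ nbrs A u → v ≢ x
    v∉N x∈N refl = contradiction (trans (sym (nbrs-adj A x∈N)) nonadj) λ ()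
    adj' : ∀ {x} → x ∈ v ∷ nbrs A u → A' u x ≡ true
    adj' (here refl) = new-edge
    adj' (there x∈N) = keeps-edges (nbrs-adj A x∈N)
    new-nbrs : ∀ {j} → A' u j ≡ true → j ∈ v ∷ nbrs A u
    new-nbrs a with edge-cases a
    ... | inj₁ old = there (∈-nbrs A old)
    ... | inj₂ (inj₁ (_ , j≡v)) = here j≡v
    ... | inj₂ (inj₂ (u≡v , _)) = contradiction u≡v u≢v

  addEdge-simple : IsSimple A → u ≢ v → IsSimple A'
  addEdge-simple (symmetric , loopless) u≢v = symmetric' , loopless'
    where
    symmetric' : ∀ i j → A' i j ≡ A' j i
    symmetric' i j
      rewrite symmetric i j | ∧-comm ⌊ i ≟ᶠ u ⌋ ⌊ j ≟ᶠ v ⌋ | ∧-comm ⌊ i ≟ᶠ v ⌋ ⌊ j ≟ᶠ u ⌋ =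
      cong (A j i ∨_) (∨-comm (⌊ j ≟ᶠ v ⌋ ∧ ⌊ i ≟ᶠ u ⌋) (⌊ j ≟ᶠ u ⌋ ∧ ⌊ i ≟ᶠ v ⌋))
    loopless' : ∀ i → A' i i ≡ false
    loopless' i rewrite loopless i with i ≟ᶠ u | i ≟ᶠ v
    ... | yes i≡u | yes i≡v = contradiction (trans (sym i≡u) i≡v) u≢v
    ... | yes _ | no _ = refl
    ... | no _ | yes _ = refl
    ... | no _ | no _ = refl

  walk-avoiding-v : ∀ {P} → All (_≢ v) P → Linked (Step A') P → Linked (λ x y → A x y ≡ true) P
  walk-avoiding-v _ [] = []
  walk-avoiding-v _ [-] = [-]
  walk-avoiding-v (x≢v ∷ rest@(y≢v ∷ _)) ((a , _) ∷ l) = edge-avoiding-v a x≢v y≢v ∷ walk-avoiding-v rest l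

  Away : Fin n → Set
  Away x = x ≢ u × x ≢ v

  walk-away : ∀ {P} → All Away P → Linked (Step A') P → Linked (Step A) P
  walk-away _ [] = []
  walk-away _ [-] = [-]
  walk-away ((x≢u , x≢v) ∷ ay@((y≢u , y≢v) ∷ _)) ((a , d) ∷ l) =
    (trans (sym (row-away x≢u x≢v _)) a , subst₂ _≤_ (deg-away y≢u y≢v) (deg-away x≢u x≢v) d)
    ∷ walk-away ay l

saturation-refutes : ∀ {n k} {A : Adj n} {u v} → KSaturated k A → u ≢ v → A u v ≡ false →
                     ¬ MpLess (addEdge A u v) k
saturation-refutes (_ , saturated) u≢v nonadj mp' with saturated _ _ u≢v nonadj
... | p , mono , k≤p = <⇒≱ (mp' p mono) k≤p

module NonEdge {n} (A : Adj n) (simple : IsSimple A) {u v : Fin n}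
               (u≢v : u ≢ v) (nonadj : A u v ≡ false) where
  open AddEdge A u v public

  simple' : IsSimple A'
  simple' = addEdge-simple simple u≢v

  open Simple simple
  open Simple simple' using () renaming (adj-sym to adj'-sym)

  deg'-u : deg A' u ≡ suc (deg A u)
  deg'-u = deg-u u≢v nonadj

  -- Likewise for v, since G + uv = G + vu.
  deg'-v : deg A' v ≡ suc (deg A v)
  deg'-v = trans (deg-cong A' {addEdge A v u} {v} {v} swap) (AddEdge.deg-u A v u (u≢v ∘ sym) nonadj-vu)
    where
    swap : ∀ j → A' v j ≡ addEdge A v u v j
    swap j = cong (A v j ∨_) (∨-comm (⌊ v ≟ᶠ u ⌋ ∧ ⌊ j ≟ᶠ v ⌋) _)
    nonadj-vu : A v u ≡ false
    nonadj-vu = trans (proj₁ simple v u) nonadj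

  -- Joining a vertex u of degree ≤ 1 to a vertex v of maximum degree among the others
  -- makes v the unique vertex of maximum degree, so v can only start a descending path.
  -- Descending paths of G + uv then either are descending paths of G or run through
  -- u as their first vertex after v; the latter are bounded by the hypothesis through-u.
  module Apex {k} (mp : MpLess A k) (deg-u≤1 : deg A u ≤ 1)
              (v-max : ∀ y → y ≢ u → deg A y ≤ deg A v) (u<v : deg A u < deg A v)
              (through-u : ∀ Q → Descending A' (u ∷ Q) → v ∉ Q → 2 + length Q < k) where

    v-strict-max : StrictMax A' v
    v-strict-max y y≢v with u ≟ᶠ y
    ... | yes u≡y = subst (λ z → deg A' z < deg A' v) u≡y
                          (subst₂ _<_ (sym deg'-u) (sym deg'-v) (s≤s u<v))
    ... | no u≢y = subst₂ _<_ (sym (deg-away (u≢y ∘ sym) y≢v)) (sym deg'-v)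
                          (s≤s (v-max y (u≢y ∘ sym)))

    -- A step of G + uv not leaving u and not touching v is a step of G: entering u is
    -- fine since its degree went up.
    step-in-G : ∀ {x y} → Step A' x y → x ≢ u → x ≢ v → y ≢ v → Step A x y
    step-in-G {x} {y} (a , d) x≢u x≢v y≢v = edge-avoiding-v a x≢v y≢v , deg-step
      where
      deg-step : deg A y ≤ deg A x
      deg-step with u ≟ᶠ y
      ... | yes refl = ≤-trans (n≤1+n _) (subst₂ _≤_ deg'-u (deg-away x≢u x≢v) d)
      ... | no u≢y = subst₂ _≤_ (deg-away (u≢y ∘ sym) y≢v) (deg-away x≢u x≢v) d

    -- A descending path of G + uv avoiding v and not starting at u is one of G:
    -- u, having degree ≤ 1 in G, can only be its last vertex.
    walk-in-G : ∀ x xs → Descending A' (x ∷ xs) → v ∉ x ∷ xs → x ≢ u → Linked (Step A) (x ∷ xs)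
    walk-in-G x [] _ _ _ = [-]
    walk-in-G x (y ∷ []) (_ , s ∷ _) v∉ x≢u =
      step-in-G s x≢u (v∉ ∘ here ∘ sym) (v∉ ∘ there ∘ here ∘ sym) ∷ [-]
    walk-in-G x (y ∷ z ∷ zs) desc@(x∉ ∷ _ , s ∷ s' ∷ _) v∉ x≢u =
      step-in-G s x≢u x≢v y≢v ∷ walk-in-G y (z ∷ zs) (descending-tail desc) (v∉ ∘ there) y≢u
      where
      x≢v : x ≢ v
      x≢v = v∉ ∘ here ∘ sym
      y≢v : y ≢ v
      y≢v = v∉ ∘ there ∘ here ∘ sym
      -- an interior u would have the two neighbours x and z in G
      y≢u : y ≢ u
      y≢u y≡u = <⇒≱ (s≤s deg-u≤1) (subst (λ w → 2 ≤ deg A w) y≡u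
        (two-nbrs A (adj-sym (proj₁ (step-in-G s x≢u x≢v y≢v)))
                    (edge-avoiding-v (proj₁ s') y≢v (v∉ ∘ there ∘ there ∘ here ∘ sym))
                    (All.lookup x∉ (there (here refl)))))

    apex-harmless : MpLess A' k
    apex-harmless = mp<-from-descending simple' bound
      where
      2<k : 2 < k
      2<k = through-u [] ([] ∷ [] , [-]) λ ()
      bound : ∀ p → Descending A' p → length p < k
      bound [] _ = ≤-trans (s≤s z≤n) 2<k
      bound (x ∷ xs) desc with v ≟ᶠ x
      bound (x ∷ xs) desc | no v≢x with u ≟ᶠ x
      ... | yes refl = ≤-trans (n≤1+n _) (through-u xs desc (strict-max-first v-strict-max desc))
      ... | no u≢x = descending-bound mp (proj₁ desc , walk-in-G x xs desc v∉ (u≢x ∘ sym))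
        where
        v∉ : v ∉ x ∷ xs
        v∉ (here v≡x) = v≢x v≡x
        v∉ (there v∈xs) = strict-max-first v-strict-max desc v∈xs
      bound (x ∷ []) desc | yes refl = ≤-trans (s≤s (s≤s z≤n)) 2<k
      bound (x ∷ y ∷ ys) desc@(_ , (a , _) ∷ _) | yes refl with u ≟ᶠ y
      ... | yes refl = through-u ys (descending-tail desc) (head-fresh desc ∘ there)
      ... | no u≢y = descending-bound mp
            (proj₁ desc , (edge-avoiding-u a (u≢v ∘ sym) (u≢y ∘ sym) , v-max y (u≢y ∘ sym))
                          ∷ walk-in-G y ys (descending-tail desc) (head-fresh desc) (u≢y ∘ sym))

  -- If all degrees of G are at most 1, then only u and v have degree ≥ 2 in G + uv, while
  -- the first three vertices of a descending path on 4 vertices would all have degree ≥ 2.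
  low-degree-harmless : (∀ y → deg A y ≤ 1) → ∀ {k} → 4 ≤ k → MpLess A' k
  low-degree-harmless low {k} 4≤k = mp<-from-descending simple' bound
    where
    endpoint : ∀ {y} → 2 ≤ deg A' y → y ∈ u ∷ v ∷ []
    endpoint {y} 2≤deg with u ≟ᶠ y | v ≟ᶠ y
    ... | yes u≡y | _ = here (sym u≡y)
    ... | no _ | yes v≡y = there (here (sym v≡y))
    ... | no u≢y | no v≢y =
      contradiction (subst (2 ≤_) (deg-away (u≢y ∘ sym) (v≢y ∘ sym)) 2≤deg) (<⇒≱ (s≤s (low y)))
    bound : ∀ p → Descending A' p → length p < k
    bound (x₁ ∷ x₂ ∷ x₃ ∷ x₄ ∷ _) ((u₁ ∷ u₂ ∷ _) , (a₁ , d₁) ∷ (a₂ , _) ∷ (a₃ , _) ∷ _) =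
      contradiction (length-mono distinct (λ { (here refl) → endpoint (≤-trans 2≤x₂ d₁)
                                             ; (there (here refl)) → endpoint 2≤x₂
                                             ; (there (there (here refl))) → endpoint 2≤x₃ }))
                    λ { (s≤s (s≤s ())) }
      where
      distinct : Unique (x₁ ∷ x₂ ∷ x₃ ∷ [])
      distinct = (All.lookup u₁ (here refl) ∷ All.lookup u₁ (there (here refl)) ∷ [])
                 ∷ (All.lookup u₂ (here refl) ∷ []) ∷ [] ∷ []
      2≤x₂ : 2 ≤ deg A' x₂
      2≤x₂ = two-nbrs A' (adj'-sym a₁) a₂ (All.lookup u₁ (there (here refl)))
      2≤x₃ : 2 ≤ deg A' x₃
      2≤x₃ = two-nbrs A' (adj'-sym a₂) a₃ (All.lookup u₂ (there (here refl)))
    bound [] _ = ≤-trans (s≤s z≤n) 4≤k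
    bound (_ ∷ []) _ = ≤-trans (s≤s (s≤s z≤n)) 4≤k
    bound (_ ∷ _ ∷ []) _ = ≤-trans (s≤s (s≤s (s≤s z≤n))) 4≤k
    bound (_ ∷ _ ∷ _ ∷ []) _ = 4≤k

propagate : ∀ {P Q : X → Set} {R : X → X → Set} → (∀ {x y} → P x → R x y → Q y → P y) →
            ∀ {x xs} → Linked R (x ∷ xs) → All Q xs → P x → All P (x ∷ xs)
propagate pass [-] [] px = px ∷ []
propagate pass (r ∷ l) (qy ∷ qs) px = px ∷ propagate pass l qs (pass px r qy)

Last : (X → Set) → List X → Set
Last P [] = ⊥
Last P (x ∷ []) = P x
Last P (_ ∷ y ∷ ys) = Last P (y ∷ ys)

last-reverseAcc : ∀ {P : X → Set} {x acc} xs → Last P (x ∷ acc) → Last P (reverseAcc (x ∷ acc) xs)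
last-reverseAcc [] l = l
last-reverseAcc (y ∷ ys) l = last-reverseAcc ys l

record PathComponent {n} (A : Adj n) : Set where
  field
    c₁ c₂ c₃ : Fin n
    T : List (Fin n)
    path : IsPath A (c₁ ∷ c₂ ∷ c₃ ∷ T)
    starts-at-leaf : deg A c₁ ≡ 1
    low-degree : All (λ x → deg A x ≤ 2) (c₁ ∷ c₂ ∷ c₃ ∷ T)
    ends-at-leaf : Last (λ x → deg A x ≡ 1) (c₁ ∷ c₂ ∷ c₃ ∷ T)

module LowDegreePaths {n} (A : Adj n) (simple : IsSimple A) where
  open Simple simple

  path-closed : ∀ a L → IsPath A (a ∷ L) → All (λ x → deg A x ≤ 2) L →
                Last (λ x → deg A x ≡ 1) (a ∷ L) → ∀ {b j} → b ∈ L → A b j ≡ true → j ∈ a ∷ L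
  path-closed a (b ∷ []) (_ , ab ∷ _) _ leaf (here refl) bj = here (sole-nbr A (≤-reflexive leaf) (adj-sym ab) bj)
  path-closed a (b ∷ c ∷ L) ((a∉ ∷ _) , ab ∷ bc ∷ _) (deg-b ∷ _) _ (here refl) bj =
    [ here , there ∘ there ∘ here ]′ (two-nbrs-only A deg-b (adj-sym ab) bc (All.lookup a∉ (there (here refl))) bj)
  path-closed a (b ∷ L) ((_ ∷ u) , _ ∷ l) (_ ∷ degs) leaf (there m) bj =
    there (path-closed b L (u , l) degs leaf m bj)

  descending-from-two : ∀ x L → IsPath A (x ∷ L) → deg A x ≡ 2 → All (λ y → deg A y ≤ 2) L →
                        Linked (Step A) (x ∷ L)
  descending-from-two x [] _ _ _ = [-]
  descending-from-two x (y ∷ []) (_ , a ∷ _) deg-x (deg-y ∷ _) = (a , subst (_ ≤_) (sym deg-x) deg-y) ∷ [-]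
  descending-from-two x (y ∷ z ∷ L) ((x∉ ∷ u) , a ∷ l) deg-x (deg-y ∷ degs) =
    (a , subst (_ ≤_) (sym deg-x) deg-y)
    ∷ descending-from-two y (z ∷ L) (u , l)
        (≤-antisym deg-y (two-nbrs A (adj-sym a) (Linked.head l) (All.lookup x∉ (there (here refl))))) degs

  -- Unless G has a path component, prepending a neighbour y to a path that starts at a
  -- vertex z of degree 2 (and then runs through degree ≤ 2 to a leaf) yields a longer
  -- descending path: y is no leaf, so deg y ≥ 2 = deg z.
  prepend : ¬ PathComponent A → ∀ y z z₂ R → IsPath A (y ∷ z ∷ z₂ ∷ R) → deg A z ≡ 2 →
            All (λ x → deg A x ≤ 2) (z ∷ z₂ ∷ R) → Last (λ x → deg A x ≡ 1) (z₂ ∷ R) →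
            ∃ λ P → Descending A P × length P ≡ length (y ∷ z ∷ z₂ ∷ R)
  prepend no-pc y z z₂ R path@(u , yz ∷ l) deg-z degs leaf with deg A y ≟ 1
  ... | yes y-leaf = ⊥-elim (no-pc (record { path = path ; starts-at-leaf = y-leaf
                                            ; low-degree = ≤-trans (≤-reflexive y-leaf) (n≤1+n 1) ∷ degs
                                            ; ends-at-leaf = leaf }))
  ... | no y-not-leaf =
    y ∷ z ∷ z₂ ∷ R ,
    (u , (yz , z≤y) ∷ descending-from-two z (z₂ ∷ R) (AllPairs.tail u , l) deg-z (All.tail degs)) ,
    refl
    where
    z≤y : deg A z ≤ deg A y
    z≤y = subst (_≤ _) (sym deg-z) (≤∧≢⇒< (nbr⇒deg≥1 A yz) (y-not-leaf ∘ sym))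

  -- Unless G has a path component, a path on ≥ 3 vertices of degree ≤ 2 that ends at a leaf
  -- prolongs at its start to a longer descending path: its first vertex z is no leaf, so
  -- it has a second neighbour y, which lies off the path by path-closed.
  extend : ¬ PathComponent A → ∀ R → 3 ≤ length R → IsPath A R → All (λ x → deg A x ≤ 2) R →
           Last (λ x → deg A x ≡ 1) R → ∃ λ P → Descending A P × length P ≡ suc (length R)
  extend no-pc (z ∷ z₂ ∷ t ∷ T) _ (z∉ ∷ u , a ∷ l) (deg-z ∷ degs) leaf with deg A z ≟ 1
  ... | yes z-leaf = ⊥-elim (no-pc (record { path = z∉ ∷ u , a ∷ l ; starts-at-leaf = z-leaf
                                            ; low-degree = deg-z ∷ degs ; ends-at-leaf = leaf }))
  ... | no z-not-leaf with ≤∧≢⇒< (nbr⇒deg≥1 A a) (z-not-leaf ∘ sym)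
  ... | 1<deg-z with new-neighbour A (z₂ ∷ []) 1<deg-z
  ... | y , zy , y≢z₂ =
    prepend no-pc y z z₂ (t ∷ T) (y-fresh ∷ z∉ ∷ u , adj-sym zy ∷ a ∷ l)
            (≤-antisym deg-z 1<deg-z) (deg-z ∷ degs) leaf
    where
    y-fresh : All (y ≢_) (z ∷ z₂ ∷ t ∷ T)
    y-fresh = ¬Any⇒All¬ _ λ
      { (here refl) → adj-distinct zy refl
      ; (there (here refl)) → y≢z₂ (here refl)
      ; (there (there y∈)) →
          All.lookup z∉ (path-closed z₂ (t ∷ T) (u , l) (All.tail degs) leaf y∈ (adj-sym zy)) refl }
  extend _ (_ ∷ []) (s≤s ()) _ _ _
  extend _ (_ ∷ _ ∷ []) (s≤s (s≤s ())) _ _ _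

  -- Read backwards, a path from a leaf u through at least two further vertices of degree ≤ 2
  -- prolongs in the same way.
  extend-from-leaf : ¬ PathComponent A → ∀ u L → IsPath A (u ∷ L) → 2 ≤ length L →
                     deg A u ≡ 1 → All (λ x → deg A x ≤ 2) L →
                     ∃ λ P → Descending A P × length P ≡ suc (length (u ∷ L))
  extend-from-leaf no-pc u L (unique , linked) 2≤L u-leaf degs
    with extend no-pc (reverse (u ∷ L)) (subst (3 ≤_) (sym (length-reverse (u ∷ L))) (s≤s 2≤L))
                (unique-reverse unique , Linked.map adj-sym (linked-reverse linked))
                (All.tabulate (low ∘ Any.reverse⁻)) (last-reverseAcc L u-leaf)
    where
    low : ∀ {x} → x ∈ u ∷ L → deg A x ≤ 2
    low (here refl) = ≤-trans (≤-reflexive u-leaf) (n≤1+n 1)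
    low (there x∈L) = All.lookup degs x∈L
  ... | P , desc , len = P , desc , trans len (cong suc (length-reverse (u ∷ L)))

-- Closing a triangle at the start of a path component, i.e. adding c₁c₃, creates no long
-- descending path: the component stays closed; if T is empty it is now a triangle, and
-- otherwise c₃ becomes its only vertex of degree 3, so a descending path inside it meets c₃
-- at most first and otherwise stays in {c₁, c₂} or in T; outside it nothing changes.
module TriangleAtPathComponent {n} (A : Adj n) (simple : IsSimple A) (pc : PathComponent A) where
  open PathComponent pc
  open Simple simple
  open LowDegreePaths A simple

  C : List (Fin n)
  C = c₁ ∷ c₂ ∷ c₃ ∷ T

  c₁∉ : All (c₁ ≢_) (c₂ ∷ c₃ ∷ T)
  c₁∉ = AllPairs.head (proj₁ path)

  c₂∉ : All (c₂ ≢_) (c₃ ∷ T)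
  c₂∉ = AllPairs.head (AllPairs.tail (proj₁ path))

  c₃∉T : c₃ ∉ T
  c₃∉T m = All.lookup (AllPairs.head (AllPairs.tail (AllPairs.tail (proj₁ path)))) m refl

  c₁≢c₃ : c₁ ≢ c₃
  c₁≢c₃ = All.lookup c₁∉ (there (here refl))

  c₁c₂ : A c₁ c₂ ≡ true
  c₁c₂ = Linked.head (proj₂ path)

  c₂c₃ : A c₂ c₃ ≡ true
  c₂c₃ = Linked.head (Linked.tail (proj₂ path))

  deg-c₂≡2 : deg A c₂ ≡ 2
  deg-c₂≡2 = ≤-antisym (All.lookup low-degree (there (here refl)))
                       (two-nbrs A (adj-sym c₁c₂) c₂c₃ c₁≢c₃)

  -- c₁ is a leaf whose neighbour is c₂, so c₁c₃ is a non-edge.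
  c₁c₃-nonadj : A c₁ c₃ ≡ false
  c₁c₃-nonadj = ¬-not λ c₁c₃ →
    All.lookup c₂∉ (here refl) (sym (sole-nbr A (≤-reflexive starts-at-leaf) c₁c₂ c₁c₃))

  -- c₂ c₃ T is a descending path of G, as c₂ has degree 2.
  tail-bound : ∀ {k} → MpLess A k → 2 + length T < k
  tail-bound mp = descending-bound mp
    (AllPairs.tail (proj₁ path) ,
     descending-from-two c₂ (c₃ ∷ T) (AllPairs.tail (proj₁ path) , Linked.tail (proj₂ path))
                         deg-c₂≡2 (All.tail (All.tail low-degree)))

  short-or-inner : T ≡ [] ⊎ deg A c₃ ≡ 2
  short-or-inner with T in T≡ | proj₂ path
  ... | [] | _ = inj₁ refl
  ... | t ∷ _ | _ ∷ _ ∷ c₃t ∷ _ =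
    inj₂ (≤-antisym (All.lookup low-degree (there (there (here refl))))
                    (two-nbrs A (adj-sym c₂c₃) c₃t (All.lookup c₂∉ (there (subst (t ∈_) (sym T≡) (here refl))))))

  open NonEdge A simple c₁≢c₃ c₁c₃-nonadj
  open Simple simple' using () renaming (adj-sym to adj'-sym)

  c₂-away : Away c₂
  c₂-away = All.lookup c₁∉ (here refl) ∘ sym , All.lookup c₂∉ (here refl)

  T-away : ∀ {t} → t ∈ T → Away t
  T-away t∈T = (λ t≡c₁ → All.lookup c₁∉ (there (there t∈T)) (sym t≡c₁)) ,
               (λ t≡c₃ → c₃∉T (subst (_∈ T) t≡c₃ t∈T))

  nbrs'-c₁ : ∀ {j} → A' c₁ j ≡ true → j ≡ c₂ ⊎ j ≡ c₃
  nbrs'-c₁ a with edge-cases a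
  ... | inj₁ old = inj₁ (sole-nbr A (≤-reflexive starts-at-leaf) c₁c₂ old)
  ... | inj₂ (inj₁ (_ , j≡c₃)) = inj₂ j≡c₃
  ... | inj₂ (inj₂ (c₁≡c₃ , _)) = contradiction c₁≡c₃ c₁≢c₃

  nbrs'-c₂ : ∀ {j} → A' c₂ j ≡ true → j ≡ c₁ ⊎ j ≡ c₃
  nbrs'-c₂ {j} a = two-nbrs-only A (All.lookup low-degree (there (here refl))) (adj-sym c₁c₂) c₂c₃ c₁≢c₃
    (trans (sym (row-away (proj₁ c₂-away) (proj₂ c₂-away) j)) a)

  nbrs'-T : ∀ {t j} → t ∈ T → A' t j ≡ true → j ∈ c₃ ∷ T
  nbrs'-T {j = j} t∈T a =
    path-closed c₃ T (AllPairs.tail (AllPairs.tail (proj₁ path)) , Linked.tail (Linked.tail (proj₂ path)))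
                (All.tail (All.tail (All.tail low-degree))) ends-at-leaf t∈T
                (trans (sym (row-away (proj₁ (T-away t∈T)) (proj₂ (T-away t∈T)) j)) a)

  nbrs'-c₃ : ∀ {j} → A' c₃ j ≡ true → j ∈ C
  nbrs'-c₃ a with edge-cases a
  ... | inj₁ old = there (path-closed c₂ (c₃ ∷ T) (AllPairs.tail (proj₁ path) , Linked.tail (proj₂ path))
                                      (All.tail (All.tail low-degree)) ends-at-leaf (here refl) old)
  ... | inj₂ (inj₁ (c₃≡c₁ , _)) = contradiction (sym c₃≡c₁) c₁≢c₃
  ... | inj₂ (inj₂ (_ , j≡c₁)) = here j≡c₁

  C-closed : ∀ {x j} → x ∈ C → A' x j ≡ true → j ∈ C
  C-closed (here refl) a = [ there ∘ here , there ∘ there ∘ here ]′ (nbrs'-c₁ a)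
  C-closed (there (here refl)) a = [ here , there ∘ there ∘ here ]′ (nbrs'-c₂ a)
  C-closed (there (there (here refl))) a = nbrs'-c₃ a
  C-closed (there (there (there t∈T))) a = there (there (nbrs'-T t∈T a))

  deg'≤2 : ∀ {x} → x ∈ C → x ≢ c₃ → deg A' x ≤ 2
  deg'≤2 (here refl) _ = ≤-reflexive (trans deg'-u (cong suc starts-at-leaf))
  deg'≤2 (there (here refl)) _ =
    subst (_≤ 2) (sym (deg-away (proj₁ c₂-away) (proj₂ c₂-away))) (All.lookup low-degree (there (here refl)))
  deg'≤2 (there (there (here refl))) x≢c₃ = contradiction refl x≢c₃
  deg'≤2 (there (there (there t∈T))) _ =
    subst (_≤ 2) (sym (deg-away (proj₁ (T-away t∈T)) (proj₂ (T-away t∈T))))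
          (All.lookup low-degree (there (there (there t∈T))))

  pair-closed : ∀ {x y} → x ∈ c₁ ∷ c₂ ∷ [] → A' x y ≡ true → c₃ ≢ y → y ∈ c₁ ∷ c₂ ∷ []
  pair-closed (here refl) a c₃≢y = [ there ∘ here , (λ y≡c₃ → contradiction (sym y≡c₃) c₃≢y) ]′
                                      (nbrs'-c₁ a)
  pair-closed (there (here refl)) a c₃≢y = [ here , (λ y≡c₃ → contradiction (sym y≡c₃) c₃≢y) ]′
                                             (nbrs'-c₂ a)

  T-closed : ∀ {x y} → x ∈ T → A' x y ≡ true → c₃ ≢ y → y ∈ T
  T-closed x∈T a c₃≢y with nbrs'-T x∈T a
  ... | here y≡c₃ = contradiction (sym y≡c₃) c₃≢y
  ... | there y∈T = y∈T

  avoid-c₃ : ∀ Q → Unique Q → Linked (λ x y → A' x y ≡ true) Q → All (_∈ C) Q → c₃ ∉ Q →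
             length Q ≤ 2 ⊎ length Q ≤ length T
  avoid-c₃ [] _ _ _ _ = inj₁ z≤n
  avoid-c₃ (q ∷ Q) u l (q∈C ∷ _) c₃∉ = starting q∈C
    where
    c₃-free : All (c₃ ≢_) Q
    c₃-free = ¬Any⇒All¬ _ (c₃∉ ∘ there)
    starting : q ∈ C → length (q ∷ Q) ≤ 2 ⊎ length (q ∷ Q) ≤ length T
    starting (here q≡c₁) = inj₁ (length-mono u (All.lookup (propagate pair-closed l c₃-free (here q≡c₁))))
    starting (there (here q≡c₂)) =
      inj₁ (length-mono u (All.lookup (propagate pair-closed l c₃-free (there (here q≡c₂)))))
    starting (there (there (here q≡c₃))) = contradiction (here (sym q≡c₃)) c₃∉
    starting (there (there (there q∈T))) = inj₂ (length-mono u (All.lookup (propagate T-closed l c₃-free q∈T)))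

  harmless : ∀ {k} → MpLess A k → 4 ≤ k → MpLess A' k
  harmless {k} mp 4≤k = mp<-from-descending simple' bound
    where
    at-most-3 : ∀ {m} → m ≤ 3 → m < k
    at-most-3 m≤3 = ≤-trans (s≤s m≤3) 4≤k
    within-T : ∀ {m} → m ≤ length T → 1 + m < k
    within-T m≤T = ≤-trans (s≤s (s≤s m≤T)) (≤-trans (n≤1+n _) (tail-bound mp))
    -- A descending path starting in C stays in C, where only c₃ can have degree 3.
    inside : ∀ p P → Descending A' (p ∷ P) → All (_∈ C) (p ∷ P) → length (p ∷ P) < k
    inside p P desc@(u , l) in-C with short-or-inner
    ... | inj₁ T≡[] =
      ≤-trans (s≤s (subst (λ L → _ ≤ 3 + length L) T≡[] (length-mono u (All.lookup in-C)))) 4≤k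
    ... | inj₂ deg-c₃≡2 with c₃ ∈? (p ∷ P)
    ...   | no c₃∉ = [ at-most-3 ∘ m≤n⇒m≤1+n , (λ m≤T → ≤-trans (n≤1+n _) (within-T m≤T)) ]′
                       (avoid-c₃ (p ∷ P) u (Linked.map proj₁ l) in-C c₃∉)
    ...   | yes (here refl) = [ at-most-3 ∘ s≤s , within-T ]′
                                (avoid-c₃ P (AllPairs.tail u) (Linked.map proj₁ (Linked.tail l)) (All.tail in-C)
                                          (head-fresh desc))
    ...   | yes (there c₃∈P) = contradiction
                                 (≤-trans (head-max desc c₃∈P) (deg'≤2 (All.lookup in-C (here refl)) p≢c₃))
                                             (<⇒≱ (≤-reflexive (sym (trans deg'-v (cong suc deg-c₃≡2)))))
      where
      p≢c₃ : p ≢ c₃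
      p≢c₃ refl = head-fresh desc c₃∈P
    -- A descending path starting outside C never enters C, so it is a path of G.
    bound : ∀ P → Descending A' P → length P < k
    bound [] _ = ≤-trans (s≤s z≤n) 4≤k
    bound (p ∷ P) desc@(u , l) with p ∈? C
    ... | yes p∈C = inside p P desc
                      (propagate (λ x∈C a _ → C-closed x∈C a) (Linked.map proj₁ l) (All.universal (λ _ → tt) P) p∈C)
    ... | no p∉C = descending-bound mp (u , walk-away (All.map away outside) l)
      where
      outside : All (_∉ C) (p ∷ P)
      outside = propagate (λ x∉C a _ y∈C → x∉C (C-closed y∈C (adj'-sym a)))
                          (Linked.map proj₁ l) (All.universal (λ _ → tt) P) p∉C
      away : ∀ {x} → x ∉ C → Away x
      away x∉C = x∉C ∘ here , x∉C ∘ there ∘ there ∘ here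

-- Two leaves u₁, u₂ at a common neighbour w of strictly maximum degree ≥ 3. Adding u₁u₂
-- keeps w the strict maximum, so w can only start a descending path; and {u₁, u₂} can only
-- be left through w. So a descending path of G + u₁u₂ stays in {u₁, u₂} after its first
-- vertex, or misses {u₁, u₂} and is a path of G.
module PendantPair {n} (A : Adj n) (simple : IsSimple A) {u₁ u₂ w : Fin n} (u₁≢u₂ : u₁ ≢ u₂)
                   (u₁-leaf : deg A u₁ ≡ 1) (u₂-leaf : deg A u₂ ≡ 1)
                   (u₁w : A u₁ w ≡ true) (u₂w : A u₂ w ≡ true)
                   (3≤w : 3 ≤ deg A w) (w-max : StrictMax A w) where
  open Simple simple

  u₁u₂-nonadj : A u₁ u₂ ≡ false
  u₁u₂-nonadj = ¬-not λ u₁u₂ → adj-distinct u₂w (sole-nbr A (≤-reflexive u₁-leaf) u₁w u₁u₂)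

  open NonEdge A simple u₁≢u₂ u₁u₂-nonadj
  open Simple simple' using () renaming (adj-sym to adj'-sym)

  S : List (Fin n)
  S = u₁ ∷ u₂ ∷ []

  w∉S : w ∉ S
  w∉S (here w≡u₁) = adj-distinct u₁w (sym w≡u₁)
  w∉S (there (here w≡u₂)) = adj-distinct u₂w (sym w≡u₂)

  -- w keeps its degree and stays the strict maximum: u₁ and u₂ now have degree 2 < 3.
  w-unchanged : deg A w ≡ deg A' w
  w-unchanged = sym (deg-away (w∉S ∘ here) (w∉S ∘ there ∘ here))

  w-max' : StrictMax A' w
  w-max' y y≢w with u₁ ≟ᶠ y | u₂ ≟ᶠ y
  ... | yes refl | _ = subst₂ _<_ (sym (trans deg'-u (cong suc u₁-leaf))) w-unchanged 3≤w
  ... | no _ | yes refl = subst₂ _<_ (sym (trans deg'-v (cong suc u₂-leaf))) w-unchanged 3≤w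
  ... | no u₁≢y | no u₂≢y =
    subst₂ _<_ (sym (deg-away (u₁≢y ∘ sym) (u₂≢y ∘ sym))) w-unchanged (w-max y y≢w)

  only-w : ∀ {x y} → x ∈ S → A x y ≡ true → y ≡ w
  only-w (here refl) = sole-nbr A (≤-reflexive u₁-leaf) u₁w
  only-w (there (here refl)) = sole-nbr A (≤-reflexive u₂-leaf) u₂w

  S-closed : ∀ {x y} → x ∈ S → A' x y ≡ true → w ≢ y → y ∈ S
  S-closed x∈S a w≢y with edge-cases a
  ... | inj₁ old = contradiction (sym (only-w x∈S old)) w≢y
  ... | inj₂ (inj₁ (_ , y≡u₂)) = there (here y≡u₂)
  ... | inj₂ (inj₂ (_ , y≡u₁)) = here y≡u₁

  harmless : ∀ {k} → MpLess A k → 4 ≤ k → MpLess A' k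
  harmless {k} mp 4≤k = mp<-from-descending simple' bound
    where
    w-free : ∀ {p P} → w ∉ p ∷ P → All (w ≢_) P
    w-free w∉ = ¬Any⇒All¬ _ (w∉ ∘ there)
    inside : ∀ {p P} → p ∈ S → w ∉ p ∷ P → Descending A' (p ∷ P) → length (p ∷ P) ≤ 2
    inside p∈S w∉ (u , l) =
      length-mono u (All.lookup (propagate S-closed (Linked.map proj₁ l) (w-free w∉) p∈S))
    outside : ∀ {p P} → p ∉ S → w ∉ p ∷ P → Linked (Step A') (p ∷ P) → All (_∉ S) (p ∷ P)
    outside p∉S w∉ l = All.map proj₁
      (propagate (λ (x∉S , w≢x) a w≢y → (λ y∈S → x∉S (S-closed y∈S (adj'-sym a) w≢x)) , w≢y)
                 (Linked.map proj₁ l) (w-free w∉) (p∉S , w∉ ∘ here))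
    in-G : ∀ {P} → All (_∉ S) P → Descending A' P → length P < k
    in-G out (u , l) =
      descending-bound mp (u , walk-away (All.map (λ x∉S → x∉S ∘ here , x∉S ∘ there ∘ here) out) l)
    avoiding-w : ∀ {p P} → w ∉ p ∷ P → Descending A' (p ∷ P) → length (p ∷ P) < k
    avoiding-w {p} w∉ desc with p ∈? S
    ... | yes p∈S = ≤-trans (s≤s (inside p∈S w∉ desc)) (≤-trans (n≤1+n 3) 4≤k)
    ... | no p∉S = in-G (outside p∉S w∉ (proj₂ desc)) desc
    bound : ∀ P → Descending A' P → length P < k
    bound [] _ = ≤-trans (s≤s z≤n) 4≤k
    -- w can only come first; after it the path avoids w
    bound (p ∷ P) desc with w ≟ᶠ p
    ... | no w≢p = avoiding-w (λ { (here w≡p) → w≢p w≡p ; (there w∈P) → strict-max-first w-max' desc w∈P }) desc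
    bound (p ∷ []) desc | yes refl = ≤-trans (s≤s (s≤s z≤n)) 4≤k
    bound (p ∷ y ∷ Q) desc | yes refl with y ∈? S
    ... | yes y∈S = ≤-trans (s≤s (s≤s (inside y∈S (head-fresh desc) (descending-tail desc)))) 4≤k
    ... | no y∉S = in-G (w∉S ∷ outside y∉S (head-fresh desc) (proj₂ (descending-tail desc))) desc

module Saturated {n} (A : Adj n) (simple : IsSimple A) {k} (sat : KSaturated k A) (4≤k : 4 ≤ k) where
  open Simple simple
  open LowDegreePaths A simple

  mp : MpLess A k
  mp = proj₁ sat

  2<k : 2 < k
  2<k = ≤-trans (s≤s (s≤s (s≤s z≤n))) 4≤k

  no-path-component : ¬ PathComponent A
  no-path-component pc = saturation-refutes sat c₁≢c₃ c₁c₃-nonadj (harmless mp 4≤k)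
    where open TriangleAtPathComponent A simple pc

  vertex-outside : (X : List (Fin n)) → length X < n → ∃ (_∉ X)
  vertex-outside X X<n with escape (allFin⁺ n) (subst (length X <_) (sym (length-tabulate id)) X<n)
  ... | x , _ , x∉X = x , x∉X

  -- No vertex is isolated: joining it to a vertex v of maximum degree would be harmless.
  no-isolated : 2 ≤ n → ∀ u → deg A u ≢ 0
  no-isolated 2≤n u deg-u≡0 with max-deg-outside A (u ∷ []) (vertex-outside (u ∷ []) 2≤n)
  ... | v , v∉ , v-max = saturation-refutes sat u≢v nonadj harmless
    where
    u≢v : u ≢ v
    u≢v u≡v = v∉ (here (sym u≡v))
    isolated : ∀ {j} → A u j ≢ true
    isolated a = contradiction (subst (1 ≤_) deg-u≡0 (nbr⇒deg≥1 A a)) λ ()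
    nonadj : A u v ≡ false
    nonadj = ¬-not isolated
    open NonEdge A simple u≢v nonadj
    others≤v : ∀ y → y ≢ u → deg A y ≤ deg A v
    others≤v y y≢u = v-max y λ { (here y≡u) → y≢u y≡u }
    -- in G + uv the only neighbour of u is v
    through-u : ∀ Q → Descending A' (u ∷ Q) → v ∉ Q → 2 + length Q < k
    through-u [] _ _ = 2<k
    through-u (y ∷ Q) (_ , (a , _) ∷ _) v∉Q with edge-cases a
    ... | inj₁ old = ⊥-elim (isolated old)
    ... | inj₂ (inj₁ (_ , y≡v)) = ⊥-elim (v∉Q (here (sym y≡v)))
    ... | inj₂ (inj₂ (u≡v , _)) = ⊥-elim (u≢v u≡v)
    harmless : MpLess A' k
    harmless with deg A v ≟ 0
    ... | yes deg-v≡0 = low-degree-harmless all-low 4≤k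
      where
      all-low : ∀ y → deg A y ≤ 1
      all-low y with u ≟ᶠ y
      ... | yes refl = subst (_≤ 1) (sym deg-u≡0) z≤n
      ... | no u≢y = ≤-trans (others≤v y (u≢y ∘ sym)) (subst (_≤ 1) (sym deg-v≡0) z≤n)
    ... | no deg-v≢0 = Apex.apex-harmless mp (subst (_≤ 1) (sym deg-u≡0) z≤n) others≤v
                                          (subst (_< deg A v) (sym deg-u≡0) (n≢0⇒n>0 deg-v≢0)) through-u

  module Leaf {u w v : Fin n} (u-leaf : deg A u ≡ 1) (uw : A u w ≡ true)
              (v∉ : v ∉ u ∷ w ∷ []) (v-max : ∀ y → y ∉ u ∷ w ∷ [] → deg A y ≤ deg A v) where

    u≢v : u ≢ v
    u≢v u≡v = v∉ (here (sym u≡v))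

    only-w : ∀ {j} → A u j ≡ true → j ≡ w
    only-w = sole-nbr A (≤-reflexive u-leaf) uw

    nonadj : A u v ≡ false
    nonadj = ¬-not λ uv → v∉ (there (here (only-w uv)))

    open NonEdge A simple u≢v nonadj

    others≤v : ∀ y → y ≢ u → y ≢ w → deg A y ≤ deg A v
    others≤v y y≢u y≢w = v-max y λ { (here y≡u) → y≢u y≡u ; (there (here y≡w)) → y≢w y≡w }

    -- A descending path of G + uv from u avoiding v is a path of G from the leaf u through
    -- vertices of degree ≤ deg'(u) = 2; it prolongs to a longer descending path of G.
    through-u : ∀ Q → Descending A' (u ∷ Q) → v ∉ Q → 2 + length Q < k
    through-u [] _ _ = 2<k
    through-u (_ ∷ []) _ _ = 4≤k
    through-u Q@(_ ∷ _ ∷ _) desc@(unique , steps) v∉Q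
      with extend-from-leaf no-path-component u Q
             (unique , walk-avoiding-v (u≢v ∷ All.tabulate λ x∈Q x≡v → v∉Q (subst (_∈ Q) x≡v x∈Q)) steps)
             (s≤s (s≤s z≤n)) u-leaf (All.tabulate low)
      where
      low : ∀ {x} → x ∈ Q → deg A x ≤ 2
      low {x} x∈Q = subst (_≤ 2) (deg-away x≢u x≢v)
                          (subst (deg A' x ≤_) (trans deg'-u (cong suc u-leaf)) (head-max desc x∈Q))
        where
        x≢u : x ≢ u
        x≢u refl = head-fresh desc x∈Q
        x≢v : x ≢ v
        x≢v refl = v∉Q x∈Q
    ... | P , desc-P , len = subst (_< k) len (descending-bound mp desc-P)

    refute-apex : 2 ≤ deg A v → deg A w ≤ deg A v → ⊥
    refute-apex 2≤v w≤v = saturation-refutes sat u≢v nonadj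
      (Apex.apex-harmless mp (≤-reflexive u-leaf) others≤v' (subst (_< deg A v) (sym u-leaf) 2≤v) through-u)
      where
      others≤v' : ∀ y → y ≢ u → deg A y ≤ deg A v
      others≤v' y y≢u with w ≟ᶠ y
      ... | yes refl = w≤v
      ... | no w≢y = others≤v y y≢u (w≢y ∘ sym)

    refute-low : deg A w ≤ 1 → deg A v ≤ 1 → ⊥
    refute-low w≤1 v≤1 = saturation-refutes sat u≢v nonadj (low-degree-harmless all-low 4≤k)
      where
      all-low : ∀ y → deg A y ≤ 1
      all-low y with u ≟ᶠ y | w ≟ᶠ y
      ... | yes refl | _ = ≤-reflexive u-leaf
      ... | no _ | yes refl = w≤1
      ... | no u≢y | no w≢y = ≤-trans (others≤v y (u≢y ∘ sym) (w≢y ∘ sym)) v≤1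

    -- If deg w = 2 and deg v ≤ 1, then u w x is a path component, x the other neighbour of w.
    refute-path : deg A w ≡ 2 → deg A v ≤ 1 → ⊥
    refute-path w≡2 v≤1 with new-neighbour A (u ∷ []) (subst (1 <_) (sym w≡2) ≤-refl)
    ... | x , wx , x∉ = no-path-component (record
      { path = ((adj-distinct uw ∷ u≢x ∷ []) ∷ (adj-distinct wx ∷ []) ∷ [] ∷ []) , uw ∷ wx ∷ [-]
      ; starts-at-leaf = u-leaf
      ; low-degree = ≤-trans (≤-reflexive u-leaf) (n≤1+n 1) ∷ ≤-reflexive w≡2
                     ∷ ≤-trans (≤-reflexive x-leaf) (n≤1+n 1) ∷ []
      ; ends-at-leaf = x-leaf })
      where
      u≢x : u ≢ x
      u≢x u≡x = x∉ (here (sym u≡x))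
      x-leaf : deg A x ≡ 1
      x-leaf = ≤-antisym (≤-trans (others≤v x (u≢x ∘ sym) (adj-distinct wx ∘ sym)) v≤1)
                         (nbr⇒deg≥1 A (adj-sym wx))

    w-strict-max : 3 ≤ deg A w × StrictMax A w
    w-strict-max with deg A w ≤? deg A v | 2 ≤? deg A v
    ... | yes w≤v | yes 2≤v = ⊥-elim (refute-apex 2≤v w≤v)
    ... | yes w≤v | no 2≰v = ⊥-elim (refute-low (≤-trans w≤v v≤1) v≤1)
      where
      v≤1 : deg A v ≤ 1
      v≤1 = ≤-pred (≰⇒> 2≰v)
    ... | no w≰v | _ with ≰⇒> w≰v
    ...   | v<w with deg A w ≤? 1 | deg A w ≟ 2
    ...     | yes w≤1 | _ = ⊥-elim (refute-low w≤1 (≤-trans (n≤1+n _) (≤-trans v<w w≤1)))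
    ...     | no _ | yes w≡2 = ⊥-elim (refute-path w≡2 (≤-pred (subst (_ <_) w≡2 v<w)))
    ...     | no w≰1 | no w≢2 = 3≤w , strict
      where
      3≤w : 3 ≤ deg A w
      3≤w = ≤∧≢⇒< (≰⇒> w≰1) (w≢2 ∘ sym)
      strict : StrictMax A w
      strict y y≢w with u ≟ᶠ y
      ... | yes refl = subst (_< deg A w) (sym u-leaf) (≤-trans (s≤s (s≤s z≤n)) 3≤w)
      ... | no u≢y = ≤-<-trans (others≤v y (u≢y ∘ sym) y≢w) v<w

  leaf-at-strict-max : 3 ≤ n → ∀ u → deg A u ≡ 1 → ∃ λ w → A u w ≡ true × 3 ≤ deg A w × StrictMax A w
  leaf-at-strict-max 3≤n u u-leaf with new-neighbour A [] (≤-reflexive (sym u-leaf))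
  ... | w , uw , _ with max-deg-outside A (u ∷ w ∷ []) (vertex-outside (u ∷ w ∷ []) 3≤n)
  ... | v , v∉ , v-max = w , uw , Leaf.w-strict-max u-leaf uw v∉ v-max

  -- Hence there are no two leaves: they would hang at the same w, and joining them is harmless.
  unique-leaf : 3 ≤ n → ∀ u₁ u₂ → deg A u₁ ≡ 1 → deg A u₂ ≡ 1 → u₁ ≡ u₂
  unique-leaf 3≤n u₁ u₂ u₁-leaf u₂-leaf
    with leaf-at-strict-max 3≤n u₁ u₁-leaf | leaf-at-strict-max 3≤n u₂ u₂-leaf
  ... | w₁ , u₁w₁ , 3≤w₁ , w₁-max | w₂ , u₂w₂ , _ , w₂-max with w₁ ≟ᶠ w₂ | u₁ ≟ᶠ u₂
  ...   | no w₁≢w₂ | _ = ⊥-elim (<-asym (w₁-max w₂ (w₁≢w₂ ∘ sym)) (w₂-max w₁ w₁≢w₂))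
  ...   | yes _ | yes u₁≡u₂ = u₁≡u₂
  ...   | yes refl | no u₁≢u₂ = ⊥-elim (saturation-refutes sat u₁≢u₂ u₁u₂-nonadj (harmless mp 4≤k))
    where open PendantPair A simple u₁≢u₂ u₁-leaf u₂-leaf u₁w₁ u₂w₂ 3≤w₁ w₁-max

  -- With no isolated vertex and at most one leaf, the degree sum is at least 2n - 1.
  degree-sum : 3 ≤ n → n + n ≤ Σ[ allFin n ] (deg A) + 1
  degree-sum 3≤n = begin
    n + n                                        ≡⟨ cong (λ m → m + m) (sym (length-tabulate {n = n} id)) ⟩
    length V + length V                          ≤⟨ Σ-≥2 V (λ x → two-per-vertex (deg A x) (no-isolated 2≤n x)) ⟩
    Σ[ V ] (λ x → deg A x + indicator (leaf x))  ≡⟨ Σ-+ V (deg A) (indicator ∘ leaf) ⟩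
    Σ[ V ] (deg A) + count leaf V                ≤⟨ +-monoʳ-≤ (Σ[ V ] (deg A)) at-most-one-leaf ⟩
    Σ[ V ] (deg A) + 1                           ∎
    where
    open ≤-Reasoning
    V : List (Fin n)
    V = allFin n
    2≤n : 2 ≤ n
    2≤n = ≤-trans (n≤1+n 2) 3≤n
    leaf : Fin n → Bool
    leaf x = ⌊ deg A x ≟ 1 ⌋
    two-per-vertex : ∀ d → d ≢ 0 → 2 ≤ d + indicator ⌊ d ≟ 1 ⌋
    two-per-vertex zero d≢0 = contradiction refl d≢0
    two-per-vertex (suc zero) _ = ≤-refl
    two-per-vertex (suc (suc d)) _ = s≤s (s≤s z≤n)
    at-most-one-leaf : count leaf V ≤ 1
    at-most-one-leaf = subst (_≤ 1) (sym (count≡length-filter leaf V))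
      (at-most-one (filter⁺ _ (allFin⁺ n)) λ x∈ y∈ → unique-leaf 3≤n _ _ (is-leaf x∈) (is-leaf y∈))
      where
      is-leaf : ∀ {x} → x ∈ filter (T? ∘ leaf) V → deg A x ≡ 1
      is-leaf x∈ = toWitness (proj₂ (∈-filter⁻ (T? ∘ leaf) {xs = V} x∈))

theorem2p4 : ∀ (n k : ℕ) → 3 ≤ n → 4 ≤ k →
    ∀ (A : Adj n) → IsSimple A → KSaturated k A → n ≤ edgeCount A
theorem2p4 n k 3≤n 4≤k A simple sat =
  halve n (edgeCount A) (subst (λ s → n + n ≤ s + 1) (handshake A simple) (degree-sum 3≤n))
  where open Saturated A simple sat 4≤k
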